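{- Let $m\ge 1$, $n=2m+1$ and $2\le\ell\le m+1$. There is a set $\mathcal{F}_{n,\ell}$ of pairwise edge-disjoint 4-cycles in $Q_n$ consisting of, for each $[--]$-chain $C$ of length $h$ with $3\le h\le 2\ell-3$, a flipping 4-cycle between the chains $g(C)$ and $p(g(C))$.
   Context: $Q_n$: vertices are bitstrings of length $n$, adjacent if they differ in one bit. $D$ is the set of bitstrings (including the empty string $\varepsilon$) with equally many 0s and 1s such that every prefix has at least as many 0s as 1s. A Greene–Kleitman chain is a string $u_0*u_1*\cdots*u_h$ of length $n$ over $\{0,1,*\}$ with $u_j\in D$, representing the path in $Q_n$ whose vertices are obtained by replacing the $*$s by $i$ ones followed by $h-i$ zeros, $i=0,\ldots,h$; $h$ is its length. It is a $[--]$-chain if $u_0=u_h=\varepsilon$. For a $[--]$-chain $C={*}\,u_1\,{*}\cdots u_{h-1}\,{*}$ of length $3\le h\le 2\ell-3$, let $a:=0\,u_1\,1\,u_2$ and $b:=u_{h-2}\,0\,u_{h-1}\,1$, and define $g(C):=C$ if $h<2\ell-3$; $g(C):=a*u_3*\cdots u_{h-1}*$ if $h=2\ell-3$ and $u_1=\varepsilon$; $g(C):={*}u_1{*}\cdots u_{h-3}{*}b$ if $h=2\ell-3$ and $u_1\ne\varepsilon$. Let $0<i<h$ be the smallest index with $u_i\neq\varepsilon$, and write $u_i=0\,v\,1\,w$ with $v,w\in D$; then $p(g(C))$ is the chain obtained from $g(C)$ by replacing the substring $u_i$ (at the positions it occupies in $C$) by ${*}\,v\,{*}\,w$. A flipping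 4-cycle between two vertex-disjoint paths $P,P'$ is a 4-cycle of $Q_n$ that shares exactly one edge with each of $P$ and $P'$. -}

module Defs where

open import Data.Bool using (Bool; true; false)
open import Data.Nat using (ℕ; zero; suc; _+_; _*_; _∸_; _≤_; _<_)
open import Data.Nat.Properties using (_≟_)
open import Data.List using (List; []; _∷_; _++_; map; concatMap; length; take; drop; upTo; filter)
open import Data.List.Relation.Unary.All using (All)
open import Data.List.Relation.Unary.Any using (Any)
open import Data.Product using (Σ; _×_; _,_; ∃)
open import Data.Sum using (_⊎_)
open import Data.Fin using (Fin)
open import Relation.Nullary using (¬_; yes; no)
open import Relation.Binary.PropositionalEquality using (_≡_; _≢_)

-- Bitstrings (vertices of Q_n are bitstrings of length n); 0 = false, 1 = true

Bits : Set
Bits = List Bool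

count : Bool → Bits → ℕ
count b [] = zero
count true  (true  ∷ xs) = suc (count true xs)
count true  (false ∷ xs) = count true xs
count false (false ∷ xs) = suc (count false xs)
count false (true  ∷ xs) = count false xs

D : Bits → Set
D u = (count false u ≡ count true u) × (∀ k → count true (take k u) ≤ count false (take k u))

hamming : Bits → Bits → ℕ
hamming [] [] = zero
hamming [] (_ ∷ _) = zero
hamming (_ ∷ _) [] = zero
hamming (true  ∷ xs) (true  ∷ ys) = hamming xs ys
hamming (false ∷ xs) (false ∷ ys) = hamming xs ys
hamming (true  ∷ xs) (false ∷ ys) = suc (hamming xs ys)
hamming (false ∷ xs) (true  ∷ ys) = suc (hamming xs ys)

Vertex : ℕ → Bits → Set
Vertex n x = length x ≡ n

Adj : Bits → Bits → Set
Adj x y = (length x ≡ length y) × (hamming x y ≡ 1)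

data Sym : Set where
  bit  : Bool → Sym
  star : Sym

Str : Set
Str = List Sym

render : List Bits → Str
render [] = []
render (b ∷ bs) = map bit b ++ concatMap (λ u → star ∷ map bit u) bs

-- the [--]-chain * u_1 * ... * u_{h-1} *  given by its inner blocks [u_1,...,u_{h-1}];
-- its length is h = 1 + length of the inner block list
chainStr : List Bits → Str
chainStr us = render ([] ∷ us ++ ([] ∷ []))

numStars : Str → ℕ
numStars [] = zero
numStars (star ∷ s) = suc (numStars s)
numStars (bit _ ∷ s) = numStars s

fill : Str → ℕ → Bits
fill [] k = []
fill (bit x ∷ s) k = x ∷ fill s k
fill (star ∷ s) zero = false ∷ fill s zero
fill (star ∷ s) (suc k) = true ∷ fill s k

OnPath : Str → Bits → Set
OnPath s x = Σ ℕ λ i → (i ≤ numStars s) × (fill s i ≡ x)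

Edge : Set
Edge = Bits × Bits

SameEdge : Edge → Edge → Set
SameEdge (a , b) (c , d) = ((a ≡ c) × (b ≡ d)) ⊎ ((a ≡ d) × (b ≡ c))

pathEdges : Str → List Edge
pathEdges s = map (λ i → fill s i , fill s (suc i)) (upTo (numStars s))

EdgeOfPath : Str → Edge → Set
EdgeOfPath s e = Any (SameEdge e) (pathEdges s)

VertexDisjoint : Str → Str → Set
VertexDisjoint s t = ∀ x → OnPath s x → ¬ OnPath t x

record Cycle4 : Set where
  constructor cyc
  field
    x0 x1 x2 x3 : Bits

open Cycle4 public

Is4Cycle : ℕ → Cycle4 → Set
Is4Cycle n c =
  Vertex n (x0 c) × Vertex n (x1 c) × Vertex n (x2 c) × Vertex n (x3 c) ×
  Adj (x0 c) (x1 c) × Adj (x1 c) (x2 c) × Adj (x2 c) (x3 c) × Adj (x3 c) (x0 c) ×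
  (x0 c ≢ x2 c) × (x1 c ≢ x3 c)

cycEdge : Cycle4 → Fin 4 → Edge
cycEdge c Fin.zero = x0 c , x1 c
cycEdge c (Fin.suc Fin.zero) = x1 c , x2 c
cycEdge c (Fin.suc (Fin.suc Fin.zero)) = x2 c , x3 c
cycEdge c (Fin.suc (Fin.suc (Fin.suc Fin.zero))) = x3 c , x0 c

SharesExactlyOneEdge : Cycle4 → Str → Set
SharesExactlyOneEdge c s =
  Σ (Fin 4) λ k → EdgeOfPath s (cycEdge c k) × (∀ k' → EdgeOfPath s (cycEdge c k') → k' ≡ k)

Flipping : Cycle4 → Str → Str → Set
Flipping c s t = VertexDisjoint s t × SharesExactlyOneEdge c s × SharesExactlyOneEdge c t

EdgeDisjoint : Cycle4 → Cycle4 → Set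
EdgeDisjoint c c' = ∀ k k' → ¬ SameEdge (cycEdge c k) (cycEdge c' k')

mergeLast2 : (Bits → Bits → Bits) → List Bits → List Bits
mergeLast2 f [] = []
mergeLast2 f (x ∷ []) = x ∷ []
mergeLast2 f (x ∷ y ∷ []) = f x y ∷ []
mergeLast2 f (x ∷ y ∷ z ∷ zs) = x ∷ mergeLast2 f (y ∷ z ∷ zs)

-- case h = 2ℓ-3 (inner blocks u_1 ... u_{h-1})
gEq : List Bits → Str
gEq (u1 ∷ u2 ∷ rest) with u1
... | [] = render ((false ∷ u1 ++ true ∷ u2) ∷ rest ++ ([] ∷ []))            -- a * u3 * ... * u_{h-1} *
... | (_ ∷ _) = render ([] ∷ mergeLast2 (λ x y → x ++ false ∷ y ++ true ∷ []) (u1 ∷ u2 ∷ rest))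
                                                                                -- * u1 * ... * u_{h-3} * b
gEq us = chainStr us

g : ℕ → List Bits → Str
g ℓ us with suc (length us) ≟ 2 * ℓ ∸ 3
... | yes _ = gEq us
... | no _  = chainStr us

replaceAt : ℕ → Str → Str → Str
replaceAt k new s = take k s ++ new ++ drop (k + length new) s

-- p(g(C)) where u_i = 0 v 1 w is the first nonempty inner block of C, preceded by
-- the (empty) inner blocks pre = [u_1, ..., u_{i-1}]; u_i occupies in C the positions
-- starting at 1 + length (render ([] ∷ pre))  (0-based)
pg : ℕ → List Bits → List Bits → Bits → Bits → Str
pg ℓ us pre v w =
  replaceAt (suc (length (render ([] ∷ pre)))) (star ∷ map bit v ++ star ∷ map bit w) (g ℓ us)

ValidChain : ℕ → ℕ → List Bits → Set
ValidChain n ℓ us =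
  All D us × (length (chainStr us) ≡ n) × (3 ≤ suc (length us)) × (suc (length us) ≤ 2 * ℓ ∸ 3)

-- Let u_i = 0 v 1 w be the first nonempty inner block of C. Then g(C) and p(g(C)) agree except that
-- u_i becomes * v * w, so filling the stars at suitable heights gives an edge of g(C) and an edge of
-- p(g(C)) whose endpoints differ pairwise in a single bit: together they form a 4-cycle, a "ladder".
-- Greene–Kleitman chains are vertex-disjoint, since a vertex determines both its chain and its
-- position (by matching 0s with 1s). A common edge of two ladders therefore forces a coincidence among
-- the chains g(C), p(g(C)), g(C'), p(g(C')) and their edge indices, and each one is excluded:
-- g is injective, p(g(C)) determines g(C) given the index, and p(g(C)) has two more stars than g(C).

module Submission where

open import Defs
open import Data.Bool using (Bool; true; false)
open import Data.Empty using (⊥-elim)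
import Data.Fin as F
open import Data.List using (List; []; _∷_; _++_; map; concatMap; take; drop; length; replicate)
open import Data.List.Properties
  using (∷-injective; ++-cancelˡ; ++-identityʳ; ++-assoc; length-++; map-++; length-map; length-replicate;
         ∷ʳ-injectiveˡ; ∷ʳ-injectiveʳ)
open import Data.List.Membership.Propositional using (find)
open import Data.List.Membership.Propositional.Properties using (∈-upTo⁺; ∈-upTo⁻)
open import Data.List.Relation.Unary.All using (All; []; _∷_)
import Data.List.Relation.Unary.All as All
open import Data.List.Relation.Unary.All.Properties using (++⁺; ++⁻ʳ)
import Data.List.Relation.Unary.Any as Any
import Data.List.Relation.Unary.Any.Properties as AnyP
open import Data.Nat using (ℕ; zero; suc; pred; _+_; _*_; _∸_; _≤_; _<_; z≤n; s≤s)
open import Data.Nat.Properties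
  using (_≟_; +-comm; +-suc; +-identityʳ; *-suc; suc-injective; ≤-refl; ≤-trans; <⇒≤; n≤1+n; m≤n⇒m≤1+n;
         1+n≰n; m≤m+n; m≤n+m; m<m+n; 0∸n≡0; n∸n≡0; m≤n⇒m∸n≡0; m+n∸n≡m; m∸n≤m; ∸-monoˡ-≤; *-monoʳ-≤;
         module ≤-Reasoning)
open import Data.Product using (Σ; ∃; _×_; _,_; proj₁; proj₂)
open import Data.Sum using (_⊎_; inj₁; inj₂)
open import Relation.Binary.PropositionalEquality
  using (_≡_; _≢_; refl; sym; trans; cong; cong₂; subst; subst₂; module ≡-Reasoning)
open import Relation.Nullary using (¬_; yes; no)

-- Dyck words

-- Walk c u e: u read as a lattice path (0 up, 1 down) from height c to height e, never below 0.
data Walk : ℕ → Bits → ℕ → Set where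
  done : ∀ {c} → Walk c [] c
  up   : ∀ {c u e} → Walk (suc c) u e → Walk c (false ∷ u) e
  down : ∀ {c u e} → Walk c u e → Walk (suc c) (true ∷ u) e

Dyck : Bits → Set
Dyck u = Walk 0 u 0

walk-++ : ∀ {a b c x y} → Walk a x b → Walk b y c → Walk a (x ++ y) c
walk-++ done q = q
walk-++ (up p) q = up (walk-++ p q)
walk-++ (down p) q = down (walk-++ p q)

walk-++⁻ : ∀ x {y a c} → Walk a (x ++ y) c → ∃ λ b → Walk a x b × Walk b y c
walk-++⁻ [] p = _ , done , p
walk-++⁻ (false ∷ x) (up p) with walk-++⁻ x p
... | b , q , r = b , up q , r
walk-++⁻ (true ∷ x) (down p) with walk-++⁻ x p
... | b , q , r = b , down q , r

walk-drift : ∀ {a b a' b' x} → Walk a x b → Walk a' x b' → a + b' ≡ a' + b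
walk-drift {a} {_} {a'} done done = +-comm a a'
walk-drift (up p) (up q) = suc-injective (walk-drift p q)
walk-drift (down p) (down q) = cong suc (walk-drift p q)

walk-lift : ∀ {a b x} → Walk a x b → Walk (suc a) x (suc b)
walk-lift done = done
walk-lift (up p) = up (walk-lift p)
walk-lift (down p) = down (walk-lift p)

dyck-wrap : ∀ {x y} → Dyck x → Dyck y → Dyck (false ∷ x ++ true ∷ y)
dyck-wrap px py = up (walk-++ (walk-lift px) (down py))

prefixCondition⇒walk : ∀ c e v → (∀ k → count true (take k v) ≤ c + count false (take k v)) →
                       count false v + c ≡ count true v + e → Walk c v e
prefixCondition⇒walk c e [] _ eq = subst (Walk c []) eq done
prefixCondition⇒walk c e (false ∷ v) pre eq =
  up (prefixCondition⇒walk (suc c) e v (λ k → subst (count true (take k v) ≤_) (+-suc c _) (pre (suc k)))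
                                       (trans (+-suc (count false v) c) eq))
prefixCondition⇒walk zero e (true ∷ v) pre eq with pre 1
... | ()
prefixCondition⇒walk (suc c) e (true ∷ v) pre eq =
  down (prefixCondition⇒walk c e v pre' (suc-injective (trans (sym (+-suc (count false v) c)) eq)))
  where
  pre' : ∀ k → count true (take k v) ≤ c + count false (take k v)
  pre' k with pre (suc k)
  ... | s≤s p = p

D⇒Dyck : ∀ {u} → D u → Dyck u
D⇒Dyck {u} (balanced , prefixes) =
  prefixCondition⇒walk 0 0 u prefixes (trans (+-identityʳ _) (trans balanced (sym (+-identityʳ _))))

++-≡-++ : ∀ {A : Set} (a b : List A) {x y : List A} → a ++ x ≡ b ++ y →
          (∃ λ t → b ≡ a ++ t × x ≡ t ++ y) ⊎ (∃ λ t → a ≡ b ++ t × y ≡ t ++ x)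
++-≡-++ [] b eq = inj₁ (b , refl , eq)
++-≡-++ (p ∷ a) [] eq = inj₂ (p ∷ a , refl , sym eq)
++-≡-++ (p ∷ a) (q ∷ b) eq with ∷-injective eq
... | refl , eq' with ++-≡-++ a b eq'
...   | inj₁ (t , e₁ , e₂) = inj₁ (t , cong (p ∷_) e₁ , e₂)
...   | inj₂ (t , e₁ , e₂) = inj₂ (t , cong (p ∷_) e₁ , e₂)

-- Greene–Kleitman chains are vertex-disjoint

-- The vertices of a Greene–Kleitman chain: fill (render (b ∷ bs)) k ≡ b ++ fillBlocks bs k.
fillBlocks : List Bits → ℕ → Bits
fillBlocks [] k = []
fillBlocks (u ∷ us) zero = false ∷ u ++ fillBlocks us zero
fillBlocks (u ∷ us) (suc k) = true ∷ u ++ fillBlocks us k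

Nondescending : Bits → Set
Nondescending X = ∀ t z {c e} → t ++ z ≡ X → Walk c t e → c ≤ e

NoDyckPrefix : Bits → Set
NoDyckPrefix X = ∀ t z → t ++ z ≡ X → Dyck t → t ≡ []

nondescending-[] : Nondescending []
nondescending-[] [] z eq done = ≤-refl

nondescending-up : ∀ {X} → Nondescending X → Nondescending (false ∷ X)
nondescending-up nd [] z eq done = ≤-refl
nondescending-up nd (false ∷ t) z eq (up w) = ≤-trans (n≤1+n _) (nd t z (proj₂ (∷-injective eq)) w)

nondescending-dyck-++ : ∀ {u X} → Dyck u → Nondescending X → Nondescending (u ++ X)
nondescending-dyck-++ {u} du nd t z {c} {e} eq wt with ++-≡-++ t u eq
... | inj₁ (s , refl , _) with walk-++⁻ t du
...   | m , wt' , _ = subst (c ≤_) (walk-drift wt wt') (m≤m+n c m)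
nondescending-dyck-++ {u} du nd t z {c} {e} eq wt | inj₂ (s , refl , eq₂) with walk-++⁻ u wt
...   | m , wu , ws = nd s z (sym eq₂) (subst (λ h → Walk h s e) (trans (walk-drift du wu) (+-identityʳ c)) ws)

nondescending-fillBlocks : ∀ {bs} → All Dyck bs → Nondescending (fillBlocks bs zero)
nondescending-fillBlocks [] = nondescending-[]
nondescending-fillBlocks (du ∷ ds) = nondescending-up (nondescending-dyck-++ du (nondescending-fillBlocks ds))

nondescending-dyck : ∀ {y} → Dyck y → Nondescending y
nondescending-dyck {y} dy = subst Nondescending (++-identityʳ y) (nondescending-dyck-++ dy nondescending-[])

noDyckPrefix-[] : NoDyckPrefix []
noDyckPrefix-[] [] z eq w = refl

noDyckPrefix-up : ∀ {X} → Nondescending X → NoDyckPrefix (false ∷ X)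
noDyckPrefix-up nd [] z eq w = refl
noDyckPrefix-up nd (false ∷ t) z eq (up w) with nd t z (proj₂ (∷-injective eq)) w
... | ()

noDyckPrefix-down : ∀ {X} → NoDyckPrefix (true ∷ X)
noDyckPrefix-down [] z eq w = refl
noDyckPrefix-down (false ∷ t) z () w

noDyckPrefix-fillBlocks : ∀ {bs} k → All Dyck bs → NoDyckPrefix (fillBlocks bs k)
noDyckPrefix-fillBlocks k [] = noDyckPrefix-[]
noDyckPrefix-fillBlocks zero (du ∷ ds) = noDyckPrefix-up (nondescending-dyck-++ du (nondescending-fillBlocks ds))
noDyckPrefix-fillBlocks (suc k) (_ ∷ _) = noDyckPrefix-down

dyck-prefix-cancel : ∀ {b b' X X'} → Dyck b → Dyck b' → NoDyckPrefix X → NoDyckPrefix X' →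
                     b ++ X ≡ b' ++ X' → b ≡ b' × X ≡ X'
dyck-prefix-cancel {b} {b'} db db' nX nX' eq = b≡b' , ++-cancelˡ b _ _ (trans eq (cong (_++ _) (sym b≡b')))
  where
  b≡b' : b ≡ b'
  b≡b' with ++-≡-++ b b' eq
  ... | inj₁ (t , refl , e) with walk-++⁻ b db'
  ...   | _ , w₁ , w₂ with walk-drift db w₁
  ...     | refl with nX t _ (sym e) w₂
  ...       | refl = sym (++-identityʳ b)
  b≡b' | inj₂ (t , refl , e) with walk-++⁻ b' db
  ...   | _ , w₁ , w₂ with walk-drift db' w₁
  ...     | refl with nX' t _ (sym e) w₂
  ...       | refl = ++-identityʳ b'

fillBlocks-injective : ∀ {bs bs' k k'} → All Dyck bs → All Dyck bs' → k ≤ length bs → k' ≤ length bs' →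
                       fillBlocks bs k ≡ fillBlocks bs' k' → bs ≡ bs' × k ≡ k'
fillBlocks-injective {[]} {[]} _ _ z≤n z≤n _ = refl , refl
fillBlocks-injective {[]} {_ ∷ _} {k' = zero} _ _ _ _ ()
fillBlocks-injective {[]} {_ ∷ _} {k' = suc _} _ _ _ _ ()
fillBlocks-injective {_ ∷ _} {[]} {zero} _ _ _ _ ()
fillBlocks-injective {_ ∷ _} {[]} {suc _} _ _ _ _ ()
fillBlocks-injective {_ ∷ _} {_ ∷ _} {zero} {suc _} _ _ _ _ ()
fillBlocks-injective {_ ∷ _} {_ ∷ _} {suc _} {zero} _ _ _ _ ()
fillBlocks-injective {u ∷ bs} {u' ∷ bs'} {zero} {zero} (du ∷ ds) (du' ∷ ds') _ _ eq
  with dyck-prefix-cancel du du' (noDyckPrefix-fillBlocks 0 ds) (noDyckPrefix-fillBlocks 0 ds') (proj₂ (∷-injective eq))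
... | refl , eq' with fillBlocks-injective ds ds' z≤n z≤n eq'
...   | refl , _ = refl , refl
fillBlocks-injective {u ∷ bs} {u' ∷ bs'} {suc k} {suc k'} (du ∷ ds) (du' ∷ ds') (s≤s k≤) (s≤s k'≤) eq
  with dyck-prefix-cancel du du' (noDyckPrefix-fillBlocks k ds) (noDyckPrefix-fillBlocks k' ds') (proj₂ (∷-injective eq))
... | refl , eq' with fillBlocks-injective ds ds' k≤ k'≤ eq'
...   | refl , refl = refl , refl

blocks : List Bits → Str
blocks = concatMap (λ u → star ∷ map bit u)

fill-map-bit : ∀ b s k → fill (map bit b ++ s) k ≡ b ++ fill s k
fill-map-bit [] s k = refl
fill-map-bit (x ∷ b) s k = cong (x ∷_) (fill-map-bit b s k)

fill-blocks : ∀ bs k → fill (blocks bs) k ≡ fillBlocks bs k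
fill-blocks [] k = refl
fill-blocks (u ∷ bs) zero = cong (false ∷_) (trans (fill-map-bit u (blocks bs) 0) (cong (u ++_) (fill-blocks bs 0)))
fill-blocks (u ∷ bs) (suc k) = cong (true ∷_) (trans (fill-map-bit u (blocks bs) k) (cong (u ++_) (fill-blocks bs k)))

fill-render : ∀ b bs k → fill (render (b ∷ bs)) k ≡ b ++ fillBlocks bs k
fill-render b bs k = trans (fill-map-bit b (blocks bs) k) (cong (b ++_) (fill-blocks bs k))

numStars-map-bit : ∀ b s → numStars (map bit b ++ s) ≡ numStars s
numStars-map-bit [] s = refl
numStars-map-bit (x ∷ b) s = numStars-map-bit b s

numStars-blocks : ∀ bs → numStars (blocks bs) ≡ length bs
numStars-blocks [] = refl
numStars-blocks (u ∷ bs) = cong suc (trans (numStars-map-bit u (blocks bs)) (numStars-blocks bs))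

numStars-render : ∀ b bs → numStars (render (b ∷ bs)) ≡ length bs
numStars-render b bs = trans (numStars-map-bit b (blocks bs)) (numStars-blocks bs)

data GKChain : Str → Set where
  gk : ∀ {b bs} → Dyck b → All Dyck bs → GKChain (render (b ∷ bs))

Label : Set
Label = Str × ℕ

ValidLabel : Label → Set
ValidLabel (s , k) = GKChain s × k ≤ numStars s

vertex : Label → Bits
vertex (s , k) = fill s k

-- b is the longest Dyck prefix of the vertex, and likewise each block after the following unmatched bit.
vertex-injective : ∀ {a a'} → ValidLabel a → ValidLabel a' → vertex a ≡ vertex a' → a ≡ a'
vertex-injective {_ , k} {_ , k'} (gk {b} {bs} db ds , k≤) (gk {b'} {bs'} db' ds' , k'≤) eq
  with dyck-prefix-cancel db db' (noDyckPrefix-fillBlocks k ds) (noDyckPrefix-fillBlocks k' ds')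
         (trans (sym (fill-render b bs k)) (trans eq (fill-render b' bs' k')))
... | refl , eq' with fillBlocks-injective ds ds' (subst (k ≤_) (numStars-render b bs) k≤)
                                                  (subst (k' ≤_) (numStars-render b' bs') k'≤) eq'
...   | refl , refl = refl

chains-vertexDisjoint : ∀ {S T} → GKChain S → GKChain T → S ≢ T → VertexDisjoint S T
chains-vertexDisjoint gS gT S≢T x (i , i≤ , refl) (i' , i'≤ , e) =
  S≢T (cong proj₁ (vertex-injective (gS , i≤) (gT , i'≤) (sym e)))

hamming-self : ∀ x → hamming x x ≡ 0
hamming-self [] = refl
hamming-self (true ∷ x) = hamming-self x
hamming-self (false ∷ x) = hamming-self x

hamming-cancelˡ : ∀ a x y → hamming (a ++ x) (a ++ y) ≡ hamming x y
hamming-cancelˡ [] x y = refl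
hamming-cancelˡ (true ∷ a) x y = hamming-cancelˡ a x y
hamming-cancelˡ (false ∷ a) x y = hamming-cancelˡ a x y

hamming-sym : ∀ x y → hamming x y ≡ hamming y x
hamming-sym [] [] = refl
hamming-sym [] (_ ∷ _) = refl
hamming-sym (_ ∷ _) [] = refl
hamming-sym (true ∷ x) (true ∷ y) = hamming-sym x y
hamming-sym (true ∷ x) (false ∷ y) = cong suc (hamming-sym x y)
hamming-sym (false ∷ x) (true ∷ y) = cong suc (hamming-sym x y)
hamming-sym (false ∷ x) (false ∷ y) = hamming-sym x y

hamming-fill-suc : ∀ s k → k < numStars s → hamming (fill s k) (fill s (suc k)) ≡ 1
hamming-fill-suc (bit true ∷ s) k k< = hamming-fill-suc s k k<
hamming-fill-suc (bit false ∷ s) k k< = hamming-fill-suc s k k<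
hamming-fill-suc (star ∷ s) zero _ = cong suc (hamming-self (fill s 0))
hamming-fill-suc (star ∷ s) (suc k) (s≤s k<) = hamming-fill-suc s k k<

length-fill : ∀ s k → length (fill s k) ≡ length s
length-fill [] k = refl
length-fill (bit x ∷ s) k = cong suc (length-fill s k)
length-fill (star ∷ s) zero = cong suc (length-fill s zero)
length-fill (star ∷ s) (suc k) = cong suc (length-fill s k)

Unordered≡ : {A : Set} → A × A → A × A → Set
Unordered≡ (a , b) (c , d) = (a ≡ c × b ≡ d) ⊎ (a ≡ d × b ≡ c)

unordered-sym : ∀ {A : Set} {e e' : A × A} → Unordered≡ e e' → Unordered≡ e' e
unordered-sym (inj₁ (p , q)) = inj₁ (sym p , sym q)
unordered-sym (inj₂ (p , q)) = inj₂ (sym q , sym p)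

unordered-swapˡ : ∀ {A : Set} {a b : A} {e : A × A} → Unordered≡ (a , b) e → Unordered≡ (b , a) e
unordered-swapˡ (inj₁ (p , q)) = inj₂ (q , p)
unordered-swapˡ (inj₂ (p , q)) = inj₁ (q , p)

unordered-swapʳ : ∀ {A : Set} {a b : A} {e : A × A} → Unordered≡ e (a , b) → Unordered≡ e (b , a)
unordered-swapʳ e = unordered-sym (unordered-swapˡ (unordered-sym e))

fill-onPath : ∀ s {k} → k ≤ numStars s → OnPath s (fill s k)
fill-onPath s {k} k≤ = k , k≤ , refl

fill-edgeOfPath : ∀ s k → k < numStars s → EdgeOfPath s (fill s k , fill s (suc k))
fill-edgeOfPath s k k< = AnyP.map⁺ (Any.map (λ { refl → inj₁ (refl , refl) }) (∈-upTo⁺ k<))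

edgeOfPath-ends : ∀ s {x y} → EdgeOfPath s (x , y) → OnPath s x × OnPath s y
edgeOfPath-ends s e with find (AnyP.map⁻ e)
... | i , i∈ , inj₁ (refl , refl) = (i , <⇒≤ (∈-upTo⁻ i∈) , refl) , (suc i , ∈-upTo⁻ i∈ , refl)
... | i , i∈ , inj₂ (refl , refl) = (suc i , ∈-upTo⁻ i∈ , refl) , (i , <⇒≤ (∈-upTo⁻ i∈) , refl)

edgeOfPath-swap : ∀ s {x y} → EdgeOfPath s (x , y) → EdgeOfPath s (y , x)
edgeOfPath-swap s = Any.map unordered-swapˡ

-- Ladders: 4-cycles between two chains

ladder : Str → ℕ → Str → ℕ → Cycle4
ladder S j T k = cyc (fill S j) (fill S (suc j)) (fill T (suc k)) (fill T k)

module Ladder {n : ℕ} {S T : Str} {j k : ℕ} (disjoint : VertexDisjoint S T)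
         (j<S : j < numStars S) (k<T : k < numStars T) (|S| : length S ≡ n) (|T| : length T ≡ n)
         (upper : hamming (fill S (suc j)) (fill T (suc k)) ≡ 1)
         (lower : hamming (fill T k) (fill S j) ≡ 1) where

  private
    S₀ = fill-onPath S (<⇒≤ j<S)
    S₁ = fill-onPath S j<S
    T₀ = fill-onPath T (<⇒≤ k<T)
    T₁ = fill-onPath T k<T

    |fill| : ∀ s i → length s ≡ n → length (fill s i) ≡ n
    |fill| s i |s| = trans (length-fill s i) |s|

  is4Cycle : Is4Cycle n (ladder S j T k)
  is4Cycle =
    |fill| S j |S| , |fill| S (suc j) |S| , |fill| T (suc k) |T| , |fill| T k |T| ,
    (trans (|fill| S j |S|) (sym (|fill| S (suc j) |S|)) , hamming-fill-suc S j j<S) ,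
    (trans (|fill| S (suc j) |S|) (sym (|fill| T (suc k) |T|)) , upper) ,
    (trans (|fill| T (suc k) |T|) (sym (|fill| T k |T|)) ,
       trans (hamming-sym (fill T (suc k)) (fill T k)) (hamming-fill-suc T k k<T)) ,
    (trans (|fill| T k |T|) (sym (|fill| S j |S|)) , lower) ,
    (λ e → disjoint _ S₀ (subst (OnPath T) (sym e) T₁)) ,
    (λ e → disjoint _ S₁ (subst (OnPath T) (sym e) T₀))

  flipping : Flipping (ladder S j T k) S T
  flipping =
    disjoint ,
    (F.zero , fill-edgeOfPath S j j<S , onlyS) ,
    (F.suc (F.suc F.zero) , edgeOfPath-swap T (fill-edgeOfPath T k k<T) , onlyT)
    where
    onlyS : ∀ i → EdgeOfPath S (cycEdge (ladder S j T k) i) → i ≡ F.zero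
    onlyS F.zero _ = refl
    onlyS (F.suc F.zero) e = ⊥-elim (disjoint _ (proj₂ (edgeOfPath-ends S e)) T₁)
    onlyS (F.suc (F.suc F.zero)) e = ⊥-elim (disjoint _ (proj₁ (edgeOfPath-ends S e)) T₁)
    onlyS (F.suc (F.suc (F.suc F.zero))) e = ⊥-elim (disjoint _ (proj₁ (edgeOfPath-ends S e)) T₀)

    onlyT : ∀ i → EdgeOfPath T (cycEdge (ladder S j T k) i) → i ≡ F.suc (F.suc F.zero)
    onlyT F.zero e = ⊥-elim (disjoint _ S₀ (proj₁ (edgeOfPath-ends T e)))
    onlyT (F.suc F.zero) e = ⊥-elim (disjoint _ S₁ (proj₁ (edgeOfPath-ends T e)))
    onlyT (F.suc (F.suc F.zero)) _ = refl
    onlyT (F.suc (F.suc (F.suc F.zero))) e = ⊥-elim (disjoint _ S₀ (proj₂ (edgeOfPath-ends T e)))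

unordered-along : ∀ {X Y : Str} {i i'} → Unordered≡ ((X , i) , (X , suc i)) ((Y , i') , (Y , suc i')) → X ≡ Y × i ≡ i'
unordered-along (inj₁ (refl , _)) = refl , refl
unordered-along (inj₂ (refl , ()))

unordered-along-across : ∀ {X Y Z : Str} {i a b} → Unordered≡ ((X , i) , (X , suc i)) ((Y , a) , (Z , b)) → Y ≡ Z
unordered-along-across (inj₁ (refl , refl)) = refl
unordered-along-across (inj₂ (refl , refl)) = refl

unordered-across : ∀ {X Y X' Y' : Str} {a b a' b' : ℕ} → Unordered≡ ((X , a) , (Y , b)) ((X' , a') , (Y' , b')) →
                   (X ≡ X' × Y ≡ Y') ⊎ (X ≡ Y' × Y ≡ X')
unordered-across (inj₁ (refl , refl)) = inj₁ (refl , refl)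
unordered-across (inj₂ (refl , refl)) = inj₂ (refl , refl)

vertices : Label × Label → Edge
vertices (a , b) = vertex a , vertex b

vertices-injective : ∀ {a b c d} → ValidLabel a → ValidLabel b → ValidLabel c → ValidLabel d →
                     SameEdge (vertices (a , b)) (vertices (c , d)) → Unordered≡ (a , b) (c , d)
vertices-injective va vb vc vd (inj₁ (p , q)) = inj₁ (vertex-injective va vc p , vertex-injective vb vd q)
vertices-injective va vb vc vd (inj₂ (p , q)) = inj₂ (vertex-injective va vd p , vertex-injective vb vc q)

ladderLabels : Str → ℕ → Str → ℕ → F.Fin 4 → Label × Label
ladderLabels S j T k F.zero = (S , j) , (S , suc j)
ladderLabels S j T k (F.suc F.zero) = (S , suc j) , (T , suc k)
ladderLabels S j T k (F.suc (F.suc F.zero)) = (T , suc k) , (T , k)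
ladderLabels S j T k (F.suc (F.suc (F.suc F.zero))) = (T , k) , (S , j)

cycEdge-ladder : ∀ S j T k i → cycEdge (ladder S j T k) i ≡ vertices (ladderLabels S j T k i)
cycEdge-ladder S j T k F.zero = refl
cycEdge-ladder S j T k (F.suc F.zero) = refl
cycEdge-ladder S j T k (F.suc (F.suc F.zero)) = refl
cycEdge-ladder S j T k (F.suc (F.suc (F.suc F.zero))) = refl

record ValidLadder (S : Str) (j : ℕ) (T : Str) (k : ℕ) : Set where
  field
    lower-chain : GKChain S
    upper-chain : GKChain T
    j<S : j < numStars S
    k<T : k < numStars T

ladderLabels-valid : ∀ {S j T k} → ValidLadder S j T k → ∀ i →
                     ValidLabel (proj₁ (ladderLabels S j T k i)) × ValidLabel (proj₂ (ladderLabels S j T k i))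
ladderLabels-valid L F.zero = (lower-chain , <⇒≤ j<S) , (lower-chain , j<S)
  where open ValidLadder L
ladderLabels-valid L (F.suc F.zero) = (lower-chain , j<S) , (upper-chain , k<T)
  where open ValidLadder L
ladderLabels-valid L (F.suc (F.suc F.zero)) = (upper-chain , k<T) , (upper-chain , <⇒≤ k<T)
  where open ValidLadder L
ladderLabels-valid L (F.suc (F.suc (F.suc F.zero))) = (upper-chain , <⇒≤ k<T) , (lower-chain , <⇒≤ j<S)
  where open ValidLadder L

-- Via vertex-injective, a common edge of two ladders is a common pair of labels; its ends lie on one chain
-- for the edges along S and T, and on two distinct chains for the rungs.
module _ {S T S' T' : Str} {j k j' k' : ℕ} (S≢T : S ≢ T) (S'≢T' : S' ≢ T') (S≢S' : S ≢ S')
         (T≡T'⇒k≢k' : T ≡ T' → k ≢ k') (S≡T'⇒j≢k' : S ≡ T' → j ≢ k') (T≡S'⇒k≢j' : T ≡ S' → k ≢ j')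
         (uncrossed : S ≡ T' → T ≢ S') where

  ladderLabels-disjoint : ∀ i i' → ¬ Unordered≡ (ladderLabels S j T k i) (ladderLabels S' j' T' k' i')
  ladderLabels-disjoint F.zero F.zero e = S≢S' (proj₁ (unordered-along e))
  ladderLabels-disjoint F.zero (F.suc F.zero) e = S'≢T' (unordered-along-across e)
  ladderLabels-disjoint F.zero (F.suc (F.suc F.zero)) e
    with unordered-along (unordered-swapʳ e)
  ... | S≡T' , j≡k' = S≡T'⇒j≢k' S≡T' j≡k'
  ladderLabels-disjoint F.zero (F.suc (F.suc (F.suc F.zero))) e = S'≢T' (sym (unordered-along-across e))
  ladderLabels-disjoint (F.suc F.zero) F.zero e = S≢T (unordered-along-across (unordered-sym e))
  ladderLabels-disjoint (F.suc F.zero) (F.suc F.zero) e with unordered-across e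
  ... | inj₁ (S≡S' , _) = S≢S' S≡S'
  ... | inj₂ (S≡T' , T≡S') = uncrossed S≡T' T≡S'
  ladderLabels-disjoint (F.suc F.zero) (F.suc (F.suc F.zero)) e =
    S≢T (unordered-along-across (unordered-swapˡ (unordered-sym e)))
  ladderLabels-disjoint (F.suc F.zero) (F.suc (F.suc (F.suc F.zero))) e with unordered-across e
  ... | inj₁ (S≡T' , T≡S') = uncrossed S≡T' T≡S'
  ... | inj₂ (S≡S' , _) = S≢S' S≡S'
  ladderLabels-disjoint (F.suc (F.suc F.zero)) F.zero e with unordered-along (unordered-swapˡ e)
  ... | T≡S' , k≡j' = T≡S'⇒k≢j' T≡S' k≡j'
  ladderLabels-disjoint (F.suc (F.suc F.zero)) (F.suc F.zero) e = S'≢T' (unordered-along-across (unordered-swapˡ e))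
  ladderLabels-disjoint (F.suc (F.suc F.zero)) (F.suc (F.suc F.zero)) e
    with unordered-along (unordered-swapʳ (unordered-swapˡ e))
  ... | T≡T' , k≡k' = T≡T'⇒k≢k' T≡T' k≡k'
  ladderLabels-disjoint (F.suc (F.suc F.zero)) (F.suc (F.suc (F.suc F.zero))) e =
    S'≢T' (sym (unordered-along-across (unordered-swapˡ e)))
  ladderLabels-disjoint (F.suc (F.suc (F.suc F.zero))) F.zero e = S≢T (sym (unordered-along-across (unordered-sym e)))
  ladderLabels-disjoint (F.suc (F.suc (F.suc F.zero))) (F.suc F.zero) e with unordered-across e
  ... | inj₁ (T≡S' , S≡T') = uncrossed S≡T' T≡S'
  ... | inj₂ (_ , S≡S') = S≢S' S≡S'
  ladderLabels-disjoint (F.suc (F.suc (F.suc F.zero))) (F.suc (F.suc F.zero)) e =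
    S≢T (sym (unordered-along-across (unordered-swapˡ (unordered-sym e))))
  ladderLabels-disjoint (F.suc (F.suc (F.suc F.zero))) (F.suc (F.suc (F.suc F.zero))) e with unordered-across e
  ... | inj₁ (_ , S≡S') = S≢S' S≡S'
  ... | inj₂ (T≡S' , S≡T') = uncrossed S≡T' T≡S'

  ladders-edgeDisjoint : ValidLadder S j T k → ValidLadder S' j' T' k' → EdgeDisjoint (ladder S j T k) (ladder S' j' T' k')
  ladders-edgeDisjoint L L' i i' same with ladderLabels-valid L i | ladderLabels-valid L' i'
  ... | va , vb | vc , vd = ladderLabels-disjoint i i'
    (vertices-injective va vb vc vd (subst₂ SameEdge (cycEdge-ladder S j T k i) (cycEdge-ladder S' j' T' k' i') same))

numStars-++ : ∀ X Z → numStars (X ++ Z) ≡ numStars X + numStars Z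
numStars-++ [] Z = refl
numStars-++ (bit x ∷ X) Z = numStars-++ X Z
numStars-++ (star ∷ X) Z = cong suc (numStars-++ X Z)

fill-++ : ∀ X Z k → fill (X ++ Z) k ≡ fill X k ++ fill Z (k ∸ numStars X)
fill-++ [] Z k = refl
fill-++ (bit x ∷ X) Z k = cong (x ∷_) (fill-++ X Z k)
fill-++ (star ∷ X) Z zero = cong (false ∷_) (trans (fill-++ X Z 0) (cong (λ i → fill X 0 ++ fill Z i) (0∸n≡0 (numStars X))))
fill-++ (star ∷ X) Z (suc k) = cong (true ∷_) (fill-++ X Z k)

hamming-fill-++ : ∀ X A B r r' {d d'} → fill X r ≡ fill X r' → r ∸ numStars X ≡ d → r' ∸ numStars X ≡ d' →
                  hamming (fill A d) (fill B d') ≡ 1 → hamming (fill (X ++ A) r) (fill (X ++ B) r') ≡ 1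
hamming-fill-++ X A B r r' same refl refl h = begin
  hamming (fill (X ++ A) r) (fill (X ++ B) r')
    ≡⟨ cong₂ hamming (fill-++ X A r) (fill-++ X B r') ⟩
  hamming (fill X r ++ fill A (r ∸ numStars X)) (fill X r' ++ fill B (r' ∸ numStars X))
    ≡⟨ cong (λ x → hamming (x ++ _) _) same ⟩
  hamming (fill X r' ++ fill A (r ∸ numStars X)) (fill X r' ++ fill B (r' ∸ numStars X))
    ≡⟨ hamming-cancelˡ (fill X r') _ _ ⟩
  hamming (fill A (r ∸ numStars X)) (fill B (r' ∸ numStars X))
    ≡⟨ h ⟩
  1 ∎
  where open ≡-Reasoning

numStars-replicate : ∀ j → numStars (replicate j star) ≡ j
numStars-replicate zero = refl
numStars-replicate (suc j) = cong suc (numStars-replicate j)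

fill-replicate : ∀ j {r} → j ≤ r → fill (replicate j star) r ≡ replicate j true
fill-replicate zero _ = refl
fill-replicate (suc j) (s≤s j≤r) = cong (true ∷_) (fill-replicate j j≤r)

-- A block u = 0 v 1 w followed by the rest Y of a chain, before and after p replaces u by * v * w.
block : Bits → Bits → Str → Str
block v w Y = map bit (false ∷ v ++ true ∷ w) ++ Y

splitBlock : Bits → Bits → Str → Str
splitBlock v w Y = star ∷ map bit v ++ star ∷ map bit w ++ Y

fill-block : ∀ v w Y t → fill (block v w Y) t ≡ false ∷ v ++ true ∷ w ++ fill Y t
fill-block v w Y t =
  trans (fill-map-bit (false ∷ v ++ true ∷ w) Y t) (cong (false ∷_) (++-assoc v (true ∷ w) (fill Y t)))

fill-splitBlock-zero : ∀ v w Y → fill (splitBlock v w Y) 0 ≡ false ∷ v ++ false ∷ w ++ fill Y 0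
fill-splitBlock-zero v w Y = cong (false ∷_) (trans (fill-map-bit v _ 0) (cong (λ x → v ++ false ∷ x) (fill-map-bit w Y 0)))

fill-splitBlock-full : ∀ v w Y t → fill (splitBlock v w Y) (suc (suc t)) ≡ true ∷ v ++ true ∷ w ++ fill Y t
fill-splitBlock-full v w Y t = cong (true ∷_) (trans (fill-map-bit v _ (suc t)) (cong (λ x → v ++ true ∷ x) (fill-map-bit w Y t)))

hamming-block-zero : ∀ v w Y → hamming (fill (splitBlock v w Y) 0) (fill (block v w Y) 0) ≡ 1
hamming-block-zero v w Y = begin
  hamming (fill (splitBlock v w Y) 0) (fill (block v w Y) 0)
    ≡⟨ cong₂ hamming (fill-splitBlock-zero v w Y) (fill-block v w Y 0) ⟩
  hamming (false ∷ v ++ false ∷ w ++ fill Y 0) (false ∷ v ++ true ∷ w ++ fill Y 0)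
    ≡⟨ hamming-cancelˡ v _ _ ⟩
  suc (hamming (w ++ fill Y 0) (w ++ fill Y 0))
    ≡⟨ cong suc (hamming-self (w ++ fill Y 0)) ⟩
  1 ∎
  where open ≡-Reasoning

hamming-block-full : ∀ v w Y t → hamming (fill (block v w Y) t) (fill (splitBlock v w Y) (suc (suc t))) ≡ 1
hamming-block-full v w Y t =
  trans (cong₂ hamming (fill-block v w Y t) (fill-splitBlock-full v w Y t)) (cong suc (hamming-self (v ++ true ∷ w ++ fill Y t)))

n≢2+n : ∀ {n} → n ≢ suc (suc n)
n≢2+n ()

-- What g(C) has in front of its first nonempty block: *^{j+1}, or 0 1 *^j when g merged u_1 = ε into 0 1 u_2.
splitPrefix : Bool → ℕ → Str
splitPrefix false j = star ∷ replicate j star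
splitPrefix true j = bit false ∷ bit true ∷ replicate j star

-- The ladder joins edge j of g(C) to edge splitEdge a j of p(g(C)). When a = true both of them flip the
-- first star after the block, which is why that case needs a star in Y.
splitEdge : Bool → ℕ → ℕ
splitEdge false j = j
splitEdge true j = suc (suc j)

unsplit : Bool → ℕ → Bits → Bits → Str → Str
unsplit a j v w Y = splitPrefix a j ++ block v w Y

split : Bool → ℕ → Bits → Bits → Str → Str
split a j v w Y = splitPrefix a j ++ splitBlock v w Y

prefixStars : Bool → ℕ → ℕ
prefixStars false j = suc j
prefixStars true j = j

numStars-splitPrefix : ∀ a j → numStars (splitPrefix a j) ≡ prefixStars a j
numStars-splitPrefix false j = cong suc (numStars-replicate j)
numStars-splitPrefix true j = numStars-replicate j

fill-splitPrefix-saturated : ∀ {j r r'} → j ≤ r → j ≤ r' → fill (splitPrefix true j) r ≡ fill (splitPrefix true j) r'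
fill-splitPrefix-saturated {j} j≤r j≤r' =
  cong (λ x → false ∷ true ∷ x) (trans (fill-replicate j j≤r) (sym (fill-replicate j j≤r')))

numStars-splitBlock : ∀ v w Y → numStars (splitBlock v w Y) ≡ suc (suc (numStars Y))
numStars-splitBlock v w Y = cong suc (trans (numStars-map-bit v _) (cong suc (numStars-map-bit w Y)))

length-splitBlock : ∀ v {w Y} → length (splitBlock v w Y) ≡ length (block v w Y)
length-splitBlock [] = refl
length-splitBlock (x ∷ v) = cong suc (length-splitBlock v)

module _ (a : Bool) (j : ℕ) (v w : Bits) (Y : Str) where

  numStars-unsplit : numStars (unsplit a j v w Y) ≡ prefixStars a j + numStars Y
  numStars-unsplit =
    trans (numStars-++ (splitPrefix a j) _) (cong₂ _+_ (numStars-splitPrefix a j) (numStars-map-bit (false ∷ v ++ true ∷ w) Y))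

  numStars-split : numStars (split a j v w Y) ≡ suc (suc (numStars (unsplit a j v w Y)))
  numStars-split = begin
    numStars (split a j v w Y)
      ≡⟨ numStars-++ (splitPrefix a j) _ ⟩
    numStars (splitPrefix a j) + numStars (splitBlock v w Y)
      ≡⟨ cong₂ _+_ (numStars-splitPrefix a j) (numStars-splitBlock v w Y) ⟩
    prefixStars a j + suc (suc (numStars Y))
      ≡⟨ trans (+-suc _ _) (cong suc (+-suc _ _)) ⟩
    suc (suc (prefixStars a j + numStars Y))
      ≡⟨ cong (λ k → suc (suc k)) (sym numStars-unsplit) ⟩
    suc (suc (numStars (unsplit a j v w Y))) ∎
    where open ≡-Reasoning

  unsplit≢split : unsplit a j v w Y ≢ split a j v w Y
  unsplit≢split e = n≢2+n (trans (cong numStars e) numStars-split)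

  length-split : length (split a j v w Y) ≡ length (unsplit a j v w Y)
  length-split = begin
    length (splitPrefix a j ++ splitBlock v w Y)          ≡⟨ length-++ (splitPrefix a j) ⟩
    length (splitPrefix a j) + length (splitBlock v w Y)  ≡⟨ cong (length (splitPrefix a j) +_) (length-splitBlock v) ⟩
    length (splitPrefix a j) + length (block v w Y)       ≡⟨ sym (length-++ (splitPrefix a j)) ⟩
    length (unsplit a j v w Y)                            ∎
    where open ≡-Reasoning

  j<numStars-unsplit : (a ≡ true → 0 < numStars Y) → j < numStars (unsplit a j v w Y)
  j<numStars-unsplit starAfter = subst (j <_) (sym numStars-unsplit) (bound a starAfter)
    where
    bound : ∀ a → (a ≡ true → 0 < numStars Y) → j < prefixStars a j + numStars Y
    bound false _ = s≤s (m≤m+n j (numStars Y))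
    bound true starAfter = m<m+n j (starAfter refl)

  splitEdge<numStars-split : (a ≡ true → 0 < numStars Y) → splitEdge a j < numStars (split a j v w Y)
  splitEdge<numStars-split starAfter = subst (splitEdge a j <_) (sym numStars-split) (bound a)
    where
    j< = j<numStars-unsplit starAfter
    bound : ∀ a' → splitEdge a' j < suc (suc (numStars (unsplit a j v w Y)))
    bound false = m≤n⇒m≤1+n (m≤n⇒m≤1+n j<)
    bound true = s≤s (s≤s j<)

upper-rung : ∀ a j v w Y → hamming (fill (unsplit a j v w Y) (suc j)) (fill (split a j v w Y) (suc (splitEdge a j))) ≡ 1
upper-rung false j v w Y =
  hamming-fill-++ (splitPrefix false j) (block v w Y) (splitBlock v w Y) (suc j) (suc j) refl j∸j j∸j
    (trans (hamming-sym (fill (block v w Y) 0) (fill (splitBlock v w Y) 0)) (hamming-block-zero v w Y))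
  where j∸j = trans (cong (j ∸_) (numStars-replicate j)) (n∸n≡0 j)
upper-rung true j v w Y =
  hamming-fill-++ (splitPrefix true j) (block v w Y) (splitBlock v w Y) (suc j) (suc (suc (suc j)))
    (fill-splitPrefix-saturated (n≤1+n j) (m≤n⇒m≤1+n (m≤n⇒m≤1+n (n≤1+n j))))
    (trans (cong (suc j ∸_) (numStars-replicate j)) (m+n∸n≡m 1 j))
    (trans (cong (suc (suc (suc j)) ∸_) (numStars-replicate j)) (m+n∸n≡m 3 j))
    (hamming-block-full v w Y 1)

lower-rung : ∀ a j v w Y → hamming (fill (split a j v w Y) (splitEdge a j)) (fill (unsplit a j v w Y) j) ≡ 1
lower-rung false j v w Y =
  hamming-fill-++ (splitPrefix false j) (splitBlock v w Y) (block v w Y) j j refl j∸1+j j∸1+j (hamming-block-zero v w Y)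
  where j∸1+j = trans (cong (λ x → j ∸ suc x) (numStars-replicate j)) (m≤n⇒m∸n≡0 (n≤1+n j))
lower-rung true j v w Y =
  hamming-fill-++ (splitPrefix true j) (splitBlock v w Y) (block v w Y) (suc (suc j)) j
    (fill-splitPrefix-saturated (m≤n⇒m≤1+n (n≤1+n j)) ≤-refl)
    (trans (cong (suc (suc j) ∸_) (numStars-replicate j)) (m+n∸n≡m 2 j))
    (trans (cong (j ∸_) (numStars-replicate j)) (n∸n≡0 j))
    (trans (hamming-sym (fill (splitBlock v w Y) 2) (fill (block v w Y) 0)) (hamming-block-full v w Y 0))

block-cons : ∀ v w Y → block v w Y ≡ bit false ∷ map bit v ++ bit true ∷ map bit w ++ Y
block-cons [] w Y = refl
block-cons (x ∷ v) w Y = cong (λ s → bit false ∷ bit x ∷ s) (proj₂ (∷-injective (block-cons v w Y)))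

map-bit-star-cancel : ∀ v v' {R R'} → map bit v ++ star ∷ R ≡ map bit v' ++ star ∷ R' → v ≡ v' × R ≡ R'
map-bit-star-cancel [] [] eq = refl , proj₂ (∷-injective eq)
map-bit-star-cancel (x ∷ v) (x' ∷ v') eq with ∷-injective eq
... | refl , eq' with map-bit-star-cancel v v' eq'
...   | refl , R≡R' = refl , R≡R'

splitBlock-injective : ∀ {v w Y v' w' Y'} → splitBlock v w Y ≡ splitBlock v' w' Y' → block v w Y ≡ block v' w' Y'
splitBlock-injective {v} {w} {Y} {v'} {w'} {Y'} eq with map-bit-star-cancel v v' (proj₂ (∷-injective eq))
... | refl , R≡R' =
  trans (block-cons v w Y) (trans (cong (λ R → bit false ∷ map bit v ++ bit true ∷ R) R≡R') (sym (block-cons v w' Y')))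

split-injective : ∀ a j v w Y a' j' v' w' Y' → split a j v w Y ≡ split a' j' v' w' Y' →
                  splitEdge a j ≡ splitEdge a' j' → unsplit a j v w Y ≡ unsplit a' j' v' w' Y'
split-injective false j v w Y false .j v' w' Y' eq refl =
  cong (splitPrefix false j ++_) (splitBlock-injective (++-cancelˡ (splitPrefix false j) _ _ eq))
split-injective true j v w Y true .j v' w' Y' eq refl =
  cong (splitPrefix true j ++_) (splitBlock-injective (++-cancelˡ (splitPrefix true j) _ _ eq))
split-injective false j v w Y true j' v' w' Y' () _
split-injective true j v w Y false j' v' w' Y' () _

-- When a = a' = true the equation is possible; it is excluded since all merged p(g(C)) have 2ℓ - 3 stars.
unsplit≡split⇒j≢splitEdge : ∀ a j v w Y a' j' v' w' Y' →
  (a ≡ true → a' ≡ true → numStars (split a j v w Y) ≡ numStars (split a' j' v' w' Y')) →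
  unsplit a j v w Y ≡ split a' j' v' w' Y' → j ≢ splitEdge a' j'
unsplit≡split⇒j≢splitEdge false j v w Y false .j v' w' Y' _ eq refl with ++-cancelˡ (splitPrefix false j) _ _ eq
... | ()
unsplit≡split⇒j≢splitEdge true j v w Y true j' v' w' Y' merged eq _ =
  n≢2+n (trans (cong numStars eq) (trans (sym (merged refl refl)) (numStars-split true j v w Y)))
unsplit≡split⇒j≢splitEdge false j v w Y true j' v' w' Y' _ () _
unsplit≡split⇒j≢splitEdge true j v w Y false j' v' w' Y' _ () _

blocks-after-empties : ∀ {pre} → All (_≡ []) pre → ∀ u rest →
                       blocks (pre ++ u ∷ rest) ≡ splitPrefix false (length pre) ++ map bit u ++ blocks rest
blocks-after-empties [] u rest = refl
blocks-after-empties (refl ∷ empties) u rest = cong (star ∷_) (blocks-after-empties empties u rest)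

splitAtReturn : ℕ → Bits → Bits × Bits
splitAtReturn c [] = [] , []
splitAtReturn c (false ∷ x) = let v , w = splitAtReturn (suc c) x in false ∷ v , w
splitAtReturn zero (true ∷ x) = [] , x
splitAtReturn (suc c) (true ∷ x) = let v , w = splitAtReturn c x in true ∷ v , w

splitAtReturn-walk : ∀ {c v e} → Walk c v e → ∀ y →
                     splitAtReturn c (v ++ y) ≡ (v ++ proj₁ (splitAtReturn e y) , proj₂ (splitAtReturn e y))
splitAtReturn-walk done y = refl
splitAtReturn-walk (up p) y = cong (λ r → false ∷ proj₁ r , proj₂ r) (splitAtReturn-walk p y)
splitAtReturn-walk (down p) y = cong (λ r → true ∷ proj₁ r , proj₂ r) (splitAtReturn-walk p y)

splitAtReturn-dyck : ∀ {v} w → Dyck v → splitAtReturn 0 (v ++ true ∷ w) ≡ (v , w)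
splitAtReturn-dyck {v} w dv = trans (splitAtReturn-walk dv (true ∷ w)) (cong (_, w) (++-identityʳ v))

-- splitAtReturn c x cuts x at the first 1 that takes the walk from c + 1 + b down to b.
splitAtReturn-spec : ∀ c {b x e} → Walk (c + suc b) x e → e ≤ b →
                     let v , w = splitAtReturn c x in x ≡ v ++ true ∷ w × Walk c v 0 × Walk b w e
splitAtReturn-spec zero (down p) e≤b = refl , done , p
splitAtReturn-spec (suc c) (down p) e≤b with splitAtReturn-spec c p e≤b
... | x≡ , pv , pw = cong (true ∷_) x≡ , down pv , pw
splitAtReturn-spec c {b} done e≤b = ⊥-elim (1+n≰n (≤-trans (s≤s (m≤n+m b c)) (subst (_≤ b) (+-suc c b) e≤b)))
splitAtReturn-spec c (up p) e≤b with splitAtReturn-spec (suc c) p e≤b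
... | x≡ , pv , pw = cong (false ∷_) x≡ , up pv , pw

dyck-decompose : ∀ {u} → Dyck u → u ≢ [] →
                 let v , w = splitAtReturn 0 (drop 1 u) in u ≡ false ∷ v ++ true ∷ w × Dyck v × Dyck w
dyck-decompose {[]} _ u≢[] = ⊥-elim (u≢[] refl)
dyck-decompose {false ∷ x} (up p) _ with splitAtReturn-spec 0 p z≤n
... | x≡ , dv , dw = cong (false ∷_) x≡ , dv , dw

firstNonempty : List Bits → List Bits × Bits × List Bits
firstNonempty [] = [] , [] , []
firstNonempty ([] ∷ us) = let pre , rest = firstNonempty us in [] ∷ pre , rest
firstNonempty ((b ∷ bs) ∷ us) = [] , b ∷ bs , us

firstNonempty-spec : ∀ {pre} → All (_≡ []) pre → ∀ u post → u ≢ [] →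
                     firstNonempty (pre ++ u ∷ post) ≡ (pre , u , post)
firstNonempty-spec [] [] post u≢[] = ⊥-elim (u≢[] refl)
firstNonempty-spec [] (b ∷ bs) post u≢[] = refl
firstNonempty-spec (refl ∷ empties) u post u≢[] =
  cong (λ r → [] ∷ proj₁ r , proj₂ r) (firstNonempty-spec empties u post u≢[])

empties-or-nonempty : ∀ (us : List Bits) → All (_≡ []) us ⊎
  (∃ λ pre → ∃ λ (u : Bits) → ∃ λ post → us ≡ pre ++ u ∷ post × All (_≡ []) pre × u ≢ [])
empties-or-nonempty [] = inj₁ []
empties-or-nonempty ((b ∷ bs) ∷ us) = inj₂ ([] , b ∷ bs , us , refl , [] , λ ())
empties-or-nonempty ([] ∷ us) with empties-or-nonempty us
... | inj₁ empties = inj₁ (refl ∷ empties)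
... | inj₂ (pre , u , post , refl , empties , u≢[]) = inj₂ ([] ∷ pre , u , post , refl , refl ∷ empties , u≢[])

g-long : ∀ ℓ us → suc (length us) ≡ 2 * ℓ ∸ 3 → g ℓ us ≡ gEq us
g-long ℓ us long with suc (length us) ≟ 2 * ℓ ∸ 3
... | yes _ = refl
... | no short = ⊥-elim (short long)

g-short : ∀ ℓ us → suc (length us) ≢ 2 * ℓ ∸ 3 → g ℓ us ≡ chainStr us
g-short ℓ us short with suc (length us) ≟ 2 * ℓ ∸ 3
... | yes long = ⊥-elim (short long)
... | no _ = refl

startsEmpty : List Bits → Bool
startsEmpty ([] ∷ _) = true
startsEmpty _ = false

-- Whether g(C) is a * u_3 * ⋯, i.e. h = 2ℓ - 3 and u_1 = ε.
merged : ℕ → List Bits → Bool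
merged ℓ us with suc (length us) ≟ 2 * ℓ ∸ 3
... | yes _ = startsEmpty us
... | no _ = false

merged-long : ∀ ℓ us → suc (length us) ≡ 2 * ℓ ∸ 3 → merged ℓ us ≡ startsEmpty us
merged-long ℓ us long with suc (length us) ≟ 2 * ℓ ∸ 3
... | yes _ = refl
... | no short = ⊥-elim (short long)

merged-short : ∀ ℓ us → suc (length us) ≢ 2 * ℓ ∸ 3 → merged ℓ us ≡ false
merged-short ℓ us short with suc (length us) ≟ 2 * ℓ ∸ 3
... | yes long = ⊥-elim (short long)
... | no _ = refl

mergeBlocks : Bits → Bits → Bits
mergeBlocks x y = x ++ false ∷ y ++ true ∷ []

dyck-mergeBlocks : ∀ {x y} → Dyck x → Dyck y → Dyck (mergeBlocks x y)
dyck-mergeBlocks dx dy = walk-++ dx (dyck-wrap dy done)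

all-mergeLast2 : ∀ {l} → All Dyck l → All Dyck (mergeLast2 mergeBlocks l)
all-mergeLast2 [] = []
all-mergeLast2 (dx ∷ []) = dx ∷ []
all-mergeLast2 (dx ∷ dy ∷ []) = dyck-mergeBlocks dx dy ∷ []
all-mergeLast2 (dx ∷ dy ∷ dz ∷ ds) = dx ∷ all-mergeLast2 (dy ∷ dz ∷ ds)

length-map-bit-++ : ∀ b R → length (map bit b ++ R) ≡ length b + length R
length-map-bit-++ b R = trans (length-++ (map bit b)) (cong (_+ length R) (length-map bit b))

length-blocks-mergeLast2 : ∀ x y zs →
  length (blocks (mergeLast2 mergeBlocks (x ∷ y ∷ zs))) ≡ length (blocks ((x ∷ y ∷ zs) ++ [] ∷ []))
length-blocks-mergeLast2 x y [] = cong suc (begin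
  length (map bit (mergeBlocks x y) ++ [])            ≡⟨ length-map-bit-++ (mergeBlocks x y) [] ⟩
  length (mergeBlocks x y) + 0                       ≡⟨ +-identityʳ _ ⟩
  length (x ++ false ∷ y ++ true ∷ [])               ≡⟨ length-++ x ⟩
  length x + suc (length (y ++ true ∷ []))           ≡⟨ cong (λ l → length x + suc l) (length-++ y) ⟩
  length x + suc (length y + length (star ∷ []))     ≡⟨ cong (λ l → length x + suc l) (sym (length-map-bit-++ y _)) ⟩
  length x + length (star ∷ map bit y ++ star ∷ [])  ≡⟨ sym (length-map-bit-++ x _) ⟩
  length (map bit x ++ star ∷ map bit y ++ star ∷ []) ∎)
  where open ≡-Reasoning
length-blocks-mergeLast2 x y (z ∷ zs) = cong suc (begin
  length (map bit x ++ blocks (mergeLast2 mergeBlocks (y ∷ z ∷ zs)))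
    ≡⟨ length-++ (map bit x) ⟩
  length (map bit x) + length (blocks (mergeLast2 mergeBlocks (y ∷ z ∷ zs)))
    ≡⟨ cong (length (map bit x) +_) (length-blocks-mergeLast2 y z zs) ⟩
  length (map bit x) + length (blocks ((y ∷ z ∷ zs) ++ [] ∷ []))
    ≡⟨ sym (length-++ (map bit x)) ⟩
  length (map bit x ++ blocks ((y ∷ z ∷ zs) ++ [] ∷ [])) ∎)
  where open ≡-Reasoning

take-++-length : ∀ {A : Set} (X Z : List A) → take (length X) (X ++ Z) ≡ X
take-++-length [] Z = refl
take-++-length (x ∷ X) Z = cong (x ∷_) (take-++-length X Z)

drop-++-length : ∀ {A : Set} (X Z : List A) k → drop (length X + k) (X ++ Z) ≡ drop k Z
drop-++-length [] Z k = refl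
drop-++-length (x ∷ X) Z k = drop-++-length X Z k

replaceAt-++ : ∀ (X M Y new : Str) → length new ≡ length M → replaceAt (length X) new (X ++ M ++ Y) ≡ X ++ new ++ Y
replaceAt-++ X M Y new |new| = cong₂ (λ p q → p ++ new ++ q) (take-++-length X (M ++ Y)) (begin
  drop (length X + length new) (X ++ M ++ Y) ≡⟨ drop-++-length X (M ++ Y) (length new) ⟩
  drop (length new) (M ++ Y)                 ≡⟨ cong (λ k → drop k (M ++ Y)) (trans |new| (sym (+-identityʳ (length M)))) ⟩
  drop (length M + 0) (M ++ Y)               ≡⟨ drop-++-length M Y 0 ⟩
  Y                                          ∎)
  where open ≡-Reasoning

blockIndex : Bool → ℕ → ℕ
blockIndex false j = j
blockIndex true j = suc j

edgeIndex : Bool → ℕ → ℕ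
edgeIndex false i = i
edgeIndex true i = pred i

length-splitPrefix : ∀ a j → length (splitPrefix a j) ≡ suc (blockIndex a j)
length-splitPrefix false j = cong suc (length-replicate j)
length-splitPrefix true j = cong (λ l → suc (suc l)) (length-replicate j)

length-blocks-empties : ∀ {L} → All (_≡ []) L → length (blocks L) ≡ length L
length-blocks-empties [] = refl
length-blocks-empties (refl ∷ empties) = cong suc (length-blocks-empties empties)

pg≡split : ∀ ℓ us {pre} a j v w Y → All (_≡ []) pre → length pre ≡ blockIndex a j →
           g ℓ us ≡ unsplit a j v w Y → pg ℓ us pre v w ≡ split a j v w Y
pg≡split ℓ us {pre} a j v w Y empties |pre| g≡ = begin
  pg ℓ us pre v w
    ≡⟨ cong₂ (λ k s → replaceAt k new s)
             (trans (cong suc (trans (length-blocks-empties empties) |pre|)) (sym (length-splitPrefix a j))) g≡ ⟩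
  replaceAt (length (splitPrefix a j)) new (splitPrefix a j ++ map bit (false ∷ v ++ true ∷ w) ++ Y)
    ≡⟨ replaceAt-++ (splitPrefix a j) _ Y new |new| ⟩
  splitPrefix a j ++ new ++ Y
    ≡⟨ cong (λ s → splitPrefix a j ++ star ∷ s) (++-assoc (map bit v) (star ∷ map bit w) Y) ⟩
  split a j v w Y ∎
  where
  open ≡-Reasoning
  new = star ∷ map bit v ++ star ∷ map bit w
  |new| : length new ≡ length (map bit (false ∷ v ++ true ∷ w))
  |new| = cong suc (begin
    length (map bit v ++ star ∷ map bit w) ≡⟨ length-map-bit-++ v _ ⟩
    length v + suc (length (map bit w))    ≡⟨ cong (λ l → length v + suc l) (length-map bit w) ⟩
    length v + length (true ∷ w)           ≡⟨ sym (length-++ v) ⟩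
    length (v ++ true ∷ w)                 ≡⟨ sym (length-map bit (v ++ true ∷ w)) ⟩
    length (map bit (v ++ true ∷ w))       ∎)

record SplitShape (ℓ n : ℕ) (us pre : List Bits) (v w : Bits) : Set where
  field
    a : Bool
    j : ℕ
    Y : Str
    merged≡ : merged ℓ us ≡ a
    length-pre : length pre ≡ blockIndex a j
    g≡unsplit : g ℓ us ≡ unsplit a j v w Y
    unsplit-chain : GKChain (unsplit a j v w Y)
    split-chain : GKChain (split a j v w Y)
    length-unsplit : length (unsplit a j v w Y) ≡ n
    starAfter : a ≡ true → 0 < numStars Y
    merged-stars : a ≡ true → numStars (split a j v w Y) ≡ 2 * ℓ ∸ 3

empties-dyck : ∀ {L} → All (_≡ []) L → All Dyck L
empties-dyck = All.map λ { refl → done }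

numStars-blocks-∷ʳ : ∀ L → numStars (blocks (L ++ [] ∷ [])) ≡ suc (length L)
numStars-blocks-∷ʳ L = trans (numStars-blocks (L ++ [] ∷ [])) (trans (length-++ L) (+-comm (length L) 1))

map-bit-++-[] : ∀ x z → map bit (x ++ z) ++ [] ≡ map bit x ++ map bit z
map-bit-++-[] x z = trans (++-identityʳ _) (map-++ bit x z)

module _ {ℓ n : ℕ} {v w : Bits} (dv : Dyck v) (dw : Dyck w) where

  shape-short : ∀ {pre} post → All (_≡ []) pre →
    suc (length (pre ++ (false ∷ v ++ true ∷ w) ∷ post)) ≢ 2 * ℓ ∸ 3 →
    All Dyck (pre ++ (false ∷ v ++ true ∷ w) ∷ post) → length (chainStr (pre ++ (false ∷ v ++ true ∷ w) ∷ post)) ≡ n →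
    SplitShape ℓ n (pre ++ (false ∷ v ++ true ∷ w) ∷ post) pre v w
  shape-short {pre} post empties short dus |C| = record
    { a = false ; j = length pre ; Y = blocks (post ++ [] ∷ [])
    ; merged≡ = merged-short ℓ us short
    ; length-pre = refl
    ; g≡unsplit = trans (g-short ℓ us short) C≡
    ; unsplit-chain = subst GKChain C≡ (gk done (++⁺ dus (done ∷ [])))
    ; split-chain = subst GKChain (blocks-after-empties empties [] _)
        (gk done (++⁺ (empties-dyck empties) (done ∷ dv ∷ dw ∷ ++⁺ (All.tail (++⁻ʳ pre dus)) (done ∷ []))))
    ; length-unsplit = trans (cong length (sym C≡)) |C|
    ; starAfter = λ ()
    ; merged-stars = λ ()
    }
    where
    us = pre ++ (false ∷ v ++ true ∷ w) ∷ post
    C≡ : chainStr us ≡ unsplit false (length pre) v w (blocks (post ++ [] ∷ []))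
    C≡ = trans (cong blocks (++-assoc pre _ ([] ∷ []))) (blocks-after-empties empties _ _)

  -- h = 2ℓ - 3 and u_1 = 0 v 1 w ≠ ε: g replaces the last two blocks by b.
  shape-head : ∀ u₂ rest → suc (length ((false ∷ v ++ true ∷ w) ∷ u₂ ∷ rest)) ≡ 2 * ℓ ∸ 3 →
    All Dyck ((false ∷ v ++ true ∷ w) ∷ u₂ ∷ rest) → length (chainStr ((false ∷ v ++ true ∷ w) ∷ u₂ ∷ rest)) ≡ n →
    SplitShape ℓ n ((false ∷ v ++ true ∷ w) ∷ u₂ ∷ rest) [] v w
  shape-head u₂ [] long (du ∷ du₂ ∷ []) |C| = record
    { a = false ; j = 0 ; Y = map bit z
    ; merged≡ = merged-long ℓ us long
    ; length-pre = refl
    ; g≡unsplit = trans (g-long ℓ us long) gEq≡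
    ; unsplit-chain = subst GKChain gEq≡ (gk done (dyck-mergeBlocks du du₂ ∷ []))
    ; split-chain = subst GKChain (cong (λ s → star ∷ star ∷ map bit v ++ star ∷ s) (map-bit-++-[] w z))
        (gk done (done ∷ dv ∷ walk-++ dw (dyck-wrap du₂ done) ∷ []))
    ; length-unsplit = trans (cong length (sym gEq≡)) (trans (length-blocks-mergeLast2 u u₂ []) |C|)
    ; starAfter = λ ()
    ; merged-stars = λ ()
    }
    where
    u = false ∷ v ++ true ∷ w
    us = u ∷ u₂ ∷ []
    z = false ∷ u₂ ++ true ∷ []
    gEq≡ : gEq us ≡ unsplit false 0 v w (map bit z)
    gEq≡ = cong (star ∷_) (map-bit-++-[] u z)
  shape-head u₂ (r ∷ rs) long (du ∷ ds) |C| = record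
    { a = false ; j = 0 ; Y = blocks (mergeLast2 mergeBlocks (u₂ ∷ r ∷ rs))
    ; merged≡ = merged-long ℓ us long
    ; length-pre = refl
    ; g≡unsplit = g-long ℓ us long
    ; unsplit-chain = gk done (all-mergeLast2 (du ∷ ds))
    ; split-chain = gk done (done ∷ dv ∷ dw ∷ all-mergeLast2 ds)
    ; length-unsplit = trans (length-blocks-mergeLast2 u u₂ (r ∷ rs)) |C|
    ; starAfter = λ ()
    ; merged-stars = λ ()
    }
    where
    u = false ∷ v ++ true ∷ w
    us = u ∷ u₂ ∷ r ∷ rs

  shape-second : ∀ post → suc (length ([] ∷ (false ∷ v ++ true ∷ w) ∷ post)) ≡ 2 * ℓ ∸ 3 →
    All Dyck ([] ∷ (false ∷ v ++ true ∷ w) ∷ post) → length (chainStr ([] ∷ (false ∷ v ++ true ∷ w) ∷ post)) ≡ n →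
    SplitShape ℓ n ([] ∷ (false ∷ v ++ true ∷ w) ∷ post) ([] ∷ []) v w
  shape-second post long (_ ∷ du ∷ dpost) |C| = record
    { a = true ; j = 0 ; Y = blocks (post ++ [] ∷ [])
    ; merged≡ = merged-long ℓ us long
    ; length-pre = refl
    ; g≡unsplit = g-long ℓ us long
    ; unsplit-chain = gk (dyck-wrap done du) (++⁺ dpost (done ∷ []))
    ; split-chain = gk (dyck-wrap done done) (dv ∷ dw ∷ ++⁺ dpost (done ∷ []))
    ; length-unsplit = |C|
    ; starAfter = λ _ → subst (0 <_) (sym (numStars-blocks-∷ʳ post)) (s≤s z≤n)
    ; merged-stars = λ _ → trans (numStars-split true 0 v w Y)
        (trans (cong (λ k → suc (suc k)) (trans (numStars-unsplit true 0 v w Y) (numStars-blocks-∷ʳ post))) long)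
    }
    where
    us = [] ∷ (false ∷ v ++ true ∷ w) ∷ post
    Y = blocks (post ++ [] ∷ [])

  shape-later : ∀ {L} post → All (_≡ []) L →
    suc (length ([] ∷ [] ∷ L ++ (false ∷ v ++ true ∷ w) ∷ post)) ≡ 2 * ℓ ∸ 3 →
    All Dyck ([] ∷ [] ∷ L ++ (false ∷ v ++ true ∷ w) ∷ post) →
    length (chainStr ([] ∷ [] ∷ L ++ (false ∷ v ++ true ∷ w) ∷ post)) ≡ n →
    SplitShape ℓ n ([] ∷ [] ∷ L ++ (false ∷ v ++ true ∷ w) ∷ post) ([] ∷ [] ∷ L) v w
  shape-later {L} post empties long (_ ∷ _ ∷ drest) |C| = record
    { a = true ; j = suc (length L) ; Y = Y
    ; merged≡ = merged-long ℓ us long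
    ; length-pre = refl
    ; g≡unsplit = trans (g-long ℓ us long) gEq≡
    ; unsplit-chain = subst GKChain gEq≡ (gk (dyck-wrap done done) (++⁺ drest (done ∷ [])))
    ; split-chain = subst GKChain (cong (λ s → bit false ∷ bit true ∷ s) (blocks-after-empties empties [] _))
        (gk (dyck-wrap done done) (++⁺ (empties-dyck empties) (done ∷ dv ∷ dw ∷ ++⁺ dpost (done ∷ []))))
    ; length-unsplit = trans (cong length (sym gEq≡)) |C|
    ; starAfter = λ _ → subst (0 <_) (sym (numStars-blocks-∷ʳ post)) (s≤s z≤n)
    ; merged-stars = λ _ → trans (numStars-split true (suc (length L)) v w Y)
        (trans (cong (λ k → suc (suc k)) (trans (numStars-unsplit true (suc (length L)) v w Y)
                                               (cong (suc (length L) +_) (numStars-blocks-∷ʳ post))))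
               (trans (cong (λ k → suc (suc (suc k))) (sym (length-++ L))) long))
    }
    where
    u = false ∷ v ++ true ∷ w
    us = [] ∷ [] ∷ L ++ u ∷ post
    Y = blocks (post ++ [] ∷ [])
    dpost = All.tail (++⁻ʳ L drest)
    gEq≡ : gEq us ≡ unsplit true (suc (length L)) v w Y
    gEq≡ = cong (λ s → bit false ∷ bit true ∷ s)
                (trans (cong blocks (++-assoc L (u ∷ post) ([] ∷ []))) (blocks-after-empties empties u _))

splitShape : ∀ {ℓ n pre post v w} → ValidChain n ℓ (pre ++ (false ∷ v ++ true ∷ w) ∷ post) →
             All (_≡ []) pre → Dyck v → Dyck w → SplitShape ℓ n (pre ++ (false ∷ v ++ true ∷ w) ∷ post) pre v w
splitShape {ℓ} {pre = pre} {post} (ds , |C| , 3≤h , _) empties dv dw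
  with suc (length (pre ++ _ ∷ post)) ≟ 2 * ℓ ∸ 3
... | no short = shape-short dv dw post empties short (All.map D⇒Dyck ds) |C|
splitShape {pre = []} {[]} (_ , _ , s≤s (s≤s ()) , _) [] dv dw | yes _
splitShape {pre = []} {u₂ ∷ rest} (ds , |C| , _ , _) [] dv dw | yes long =
  shape-head dv dw u₂ rest long (All.map D⇒Dyck ds) |C|
splitShape {pre = [] ∷ []} {post} (ds , |C| , _ , _) (refl ∷ []) dv dw | yes long =
  shape-second dv dw post long (All.map D⇒Dyck ds) |C|
splitShape {pre = [] ∷ [] ∷ L} {post} (ds , |C| , _ , _) (refl ∷ refl ∷ empties) dv dw | yes long =
  shape-later dv dw post empties long (All.map D⇒Dyck ds) |C|

ladderAt : ℕ → List Bits → List Bits → Bits → Bits → Cycle4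
ladderAt ℓ us pre v w = ladder (g ℓ us) j (pg ℓ us pre v w) (splitEdge (merged ℓ us) j)
  where j = edgeIndex (merged ℓ us) (length pre)

flipCycle : ℕ → List Bits → Cycle4
flipCycle ℓ us = let pre , u , _ = firstNonempty us ; v , w = splitAtReturn 0 (drop 1 u) in ladderAt ℓ us pre v w

flipCycle≡ladderAt : ∀ ℓ {pre} post v w → All (_≡ []) pre → Dyck v →
                     flipCycle ℓ (pre ++ (false ∷ v ++ true ∷ w) ∷ post)
                       ≡ ladderAt ℓ (pre ++ (false ∷ v ++ true ∷ w) ∷ post) pre v w
flipCycle≡ladderAt ℓ post v w empties dv
  rewrite firstNonempty-spec empties (false ∷ v ++ true ∷ w) post (λ ()) | splitAtReturn-dyck w dv = refl

module _ {ℓ n : ℕ} {us pre : List Bits} {v w : Bits} (empties : All (_≡ []) pre) (sh : SplitShape ℓ n us pre v w) where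
  open SplitShape sh

  private
    S = unsplit a j v w Y
    T = split a j v w Y
    pg≡T = pg≡split ℓ us a j v w Y empties length-pre g≡unsplit
    j<S = j<numStars-unsplit a j v w Y starAfter
    k<T = splitEdge<numStars-split a j v w Y starAfter
    module L = Ladder (chains-vertexDisjoint unsplit-chain split-chain (unsplit≢split a j v w Y)) j<S k<T
                      length-unsplit (trans (length-split a j v w Y) length-unsplit) (upper-rung a j v w Y) (lower-rung a j v w Y)

  ladderAt≡ : ladderAt ℓ us pre v w ≡ ladder S j T (splitEdge a j)
  ladderAt≡ = begin
    ladderAt ℓ us pre v w
      ≡⟨ cong₂ (λ b i → ladder (g ℓ us) (edgeIndex b i) (pg ℓ us pre v w) (splitEdge b (edgeIndex b i)))
               merged≡ length-pre ⟩
    ladder (g ℓ us) (edgeIndex a (blockIndex a j)) (pg ℓ us pre v w) (splitEdge a (edgeIndex a (blockIndex a j)))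
      ≡⟨ cong (λ i → ladder (g ℓ us) i (pg ℓ us pre v w) (splitEdge a i)) (edgeIndex-blockIndex a) ⟩
    ladder (g ℓ us) j (pg ℓ us pre v w) (splitEdge a j)
      ≡⟨ cong₂ (λ s t → ladder s j t (splitEdge a j)) g≡unsplit pg≡T ⟩
    ladder S j T (splitEdge a j) ∎
    where
    open ≡-Reasoning
    edgeIndex-blockIndex : ∀ a → edgeIndex a (blockIndex a j) ≡ j
    edgeIndex-blockIndex false = refl
    edgeIndex-blockIndex true = refl

  shape-validLadder : ValidLadder S j T (splitEdge a j)
  shape-validLadder = record { lower-chain = unsplit-chain ; upper-chain = split-chain ; j<S = j<S ; k<T = k<T }

  shape-is4Cycle : Is4Cycle n (ladderAt ℓ us pre v w)
  shape-is4Cycle = subst (Is4Cycle n) (sym ladderAt≡) L.is4Cycle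

  shape-flipping : Flipping (ladderAt ℓ us pre v w) (g ℓ us) (pg ℓ us pre v w)
  shape-flipping = subst₂ (λ c s → Flipping c s (pg ℓ us pre v w)) (sym ladderAt≡) (sym g≡unsplit)
    (subst (Flipping (ladder S j T (splitEdge a j)) S) (sym pg≡T) L.flipping)

-- Injectivity of g

render-injective : ∀ b b' bs bs' → render (b ∷ bs) ≡ render (b' ∷ bs') → b ≡ b' × bs ≡ bs'
render-injective [] [] [] [] _ = refl , refl
render-injective [] [] (u ∷ bs) (u' ∷ bs') eq with render-injective u u' bs bs' (proj₂ (∷-injective eq))
... | refl , refl = refl , refl
render-injective (x ∷ b) (x' ∷ b') bs bs' eq with ∷-injective eq
... | refl , eq' with render-injective b b' bs bs' eq'
...   | refl , refl = refl , refl
render-injective [] [] [] (_ ∷ _) ()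
render-injective [] [] (_ ∷ _) [] ()
render-injective [] (_ ∷ _) [] _ ()
render-injective [] (_ ∷ _) (_ ∷ _) _ ()
render-injective (_ ∷ _) [] _ [] ()
render-injective (_ ∷ _) [] _ (_ ∷ _) ()

mergeBlocks-injective : ∀ {x y x' y'} → Dyck x → Dyck y → Dyck x' → Dyck y' →
                        mergeBlocks x y ≡ mergeBlocks x' y' → x ≡ x' × y ≡ y'
mergeBlocks-injective {x} {y} {x'} {y'} dx dy dx' dy' eq
  with dyck-prefix-cancel dx dx' (noDyckPrefix-up (nondescending-dyck dy)) (noDyckPrefix-up (nondescending-dyck dy'))
         (∷ʳ-injectiveˡ (x ++ false ∷ y) (x' ++ false ∷ y')
           (trans (++-assoc x (false ∷ y) (true ∷ [])) (trans eq (sym (++-assoc x' (false ∷ y') (true ∷ []))))))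
... | refl , refl = refl , refl

mergeLast2-injective : ∀ {x y x' y' : Bits} {zs zs'} → All Dyck (x ∷ y ∷ zs) → All Dyck (x' ∷ y' ∷ zs') →
  mergeLast2 mergeBlocks (x ∷ y ∷ zs) ≡ mergeLast2 mergeBlocks (x' ∷ y' ∷ zs') →
  _≡_ {A = List Bits} (x ∷ y ∷ zs) (x' ∷ y' ∷ zs')
mergeLast2-injective {zs = []} {zs' = []} (dx ∷ dy ∷ []) (dx' ∷ dy' ∷ []) eq
  with mergeBlocks-injective dx dy dx' dy' (proj₁ (∷-injective eq))
... | refl , refl = refl
mergeLast2-injective {zs = z ∷ zs} {zs' = z' ∷ zs'} (_ ∷ ds) (_ ∷ ds') eq with ∷-injective eq
... | refl , eq' with mergeLast2-injective ds ds' eq'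
...   | refl = refl
mergeLast2-injective {zs = []} {zs' = _ ∷ []} _ _ ()
mergeLast2-injective {zs = []} {zs' = _ ∷ _ ∷ _} _ _ ()
mergeLast2-injective {zs = _ ∷ []} {zs' = []} _ _ ()
mergeLast2-injective {zs = _ ∷ _ ∷ _} {zs' = []} _ _ ()

mergeLast2-∷ʳ : ∀ x y zs → ∃ λ ini → ∃ λ x' → ∃ λ y' →
                mergeLast2 mergeBlocks (x ∷ y ∷ zs) ≡ ini ++ mergeBlocks x' y' ∷ []
mergeLast2-∷ʳ x y [] = [] , x , y , refl
mergeLast2-∷ʳ x y (z ∷ zs) with mergeLast2-∷ʳ y z zs
... | ini , x' , y' , eq = x ∷ ini , x' , y' , cong (x ∷_) eq

mergeBlocks≢[] : ∀ x y → mergeBlocks x y ≢ []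
mergeBlocks≢[] [] y ()
mergeBlocks≢[] (_ ∷ _) y ()

gEq-injective : ∀ {x y x' y' : Bits} {zs zs'} → All Dyck (x ∷ y ∷ zs) → All Dyck (x' ∷ y' ∷ zs') →
                gEq (x ∷ y ∷ zs) ≡ gEq (x' ∷ y' ∷ zs') → _≡_ {A = List Bits} (x ∷ y ∷ zs) (x' ∷ y' ∷ zs')
gEq-injective {[]} {y} {[]} {y'} {zs} {zs'} _ _ eq
  with render-injective (false ∷ true ∷ y) (false ∷ true ∷ y') (zs ++ [] ∷ []) (zs' ++ [] ∷ []) eq
... | refl , eq' with ∷ʳ-injectiveˡ zs zs' eq'
...   | refl = refl
gEq-injective {[]} {y} {x'@(_ ∷ _)} {y'} {zs} {zs'} _ _ eq
  with render-injective (false ∷ true ∷ y) [] (zs ++ [] ∷ []) (mergeLast2 mergeBlocks (x' ∷ y' ∷ zs')) eq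
... | () , _
gEq-injective {x@(_ ∷ _)} {y} {[]} {y'} {zs} {zs'} _ _ eq
  with render-injective [] (false ∷ true ∷ y') (mergeLast2 mergeBlocks (x ∷ y ∷ zs)) (zs' ++ [] ∷ []) eq
... | () , _
gEq-injective {x@(_ ∷ _)} {y} {x'@(_ ∷ _)} {y'} {zs} {zs'} ds ds' eq =
  mergeLast2-injective ds ds'
    (proj₂ (render-injective [] [] (mergeLast2 mergeBlocks (x ∷ y ∷ zs)) (mergeLast2 mergeBlocks (x' ∷ y' ∷ zs')) eq))

chainStr≢gEq : ∀ us x y zs → chainStr us ≢ gEq (x ∷ y ∷ zs)
chainStr≢gEq us [] y zs eq with render-injective [] (false ∷ true ∷ y) (us ++ [] ∷ []) (zs ++ [] ∷ []) eq
... | () , _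
chainStr≢gEq us (c ∷ cs) y zs eq with mergeLast2-∷ʳ (c ∷ cs) y zs
... | ini , x' , y' , eq' =
  mergeBlocks≢[] x' y' (sym (∷ʳ-injectiveʳ us ini (trans blocks≡ eq')))
  where blocks≡ = proj₂ (render-injective [] [] (us ++ [] ∷ []) (mergeLast2 mergeBlocks ((c ∷ cs) ∷ y ∷ zs)) eq)

chainStr≢long : ∀ us us' → 3 ≤ suc (length us') → chainStr us ≢ gEq us'
chainStr≢long us (x ∷ y ∷ zs) _ = chainStr≢gEq us x y zs
chainStr≢long us [] (s≤s ())
chainStr≢long us (_ ∷ []) (s≤s (s≤s ()))

chainStr-injective : ∀ {us us'} → chainStr us ≡ chainStr us' → us ≡ us'
chainStr-injective {us} {us'} eq = ∷ʳ-injectiveˡ us us' (proj₂ (render-injective [] [] (us ++ [] ∷ []) (us' ++ [] ∷ []) eq))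

g-injective : ∀ {n ℓ us us'} → ValidChain n ℓ us → ValidChain n ℓ us' → g ℓ us ≡ g ℓ us' → us ≡ us'
g-injective {ℓ = ℓ} {us} {us'} (ds , _ , 3≤h , _) (ds' , _ , 3≤h' , _) eq
  with suc (length us) ≟ 2 * ℓ ∸ 3 | suc (length us') ≟ 2 * ℓ ∸ 3
... | no _ | no _ = chainStr-injective eq
... | yes _ | yes _ = long-injective us us' 3≤h 3≤h' (All.map D⇒Dyck ds) (All.map D⇒Dyck ds') eq
  where
  long-injective : ∀ us us' → 3 ≤ suc (length us) → 3 ≤ suc (length us') → All Dyck us → All Dyck us' →
                   gEq us ≡ gEq us' → us ≡ us'
  long-injective (_ ∷ _ ∷ _) (_ ∷ _ ∷ _) _ _ ds ds' = gEq-injective ds ds'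
  long-injective [] _ (s≤s ()) _ _ _ _
  long-injective (_ ∷ []) _ (s≤s (s≤s ())) _ _ _ _
  long-injective _ [] _ (s≤s ()) _ _ _
  long-injective _ (_ ∷ []) _ (s≤s (s≤s ())) _ _ _
... | no _ | yes _ = ⊥-elim (chainStr≢long us us' 3≤h' eq)
... | yes _ | no _ = ⊥-elim (chainStr≢long us' us 3≤h (sym eq))


n≢4+n : ∀ {n} → n ≢ suc (suc (suc (suc n)))
n≢4+n ()

shapes-edgeDisjoint : ∀ {ℓ n us pre v w us' pre' v' w'} → All (_≡ []) pre → All (_≡ []) pre' →
  SplitShape ℓ n us pre v w → SplitShape ℓ n us' pre' v' w' → g ℓ us ≢ g ℓ us' →
  EdgeDisjoint (ladderAt ℓ us pre v w) (ladderAt ℓ us' pre' v' w')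
shapes-edgeDisjoint {v = v} {w} {v' = v'} {w'} empties empties' sh sh' g≢g' =
  subst₂ EdgeDisjoint (sym (ladderAt≡ empties sh)) (sym (ladderAt≡ empties' sh'))
    (ladders-edgeDisjoint (unsplit≢split a j v w Y) (unsplit≢split a' j' v' w' Y') S≢S'
      (λ T≡T' k≡k' → S≢S' (split-injective a j v w Y a' j' v' w' Y' T≡T' k≡k'))
      (unsplit≡split⇒j≢splitEdge a j v w Y a' j' v' w' Y' λ m m' → trans (merged-stars m) (sym (Sh'.merged-stars m')))
      (λ T≡S' k≡j' → unsplit≡split⇒j≢splitEdge a' j' v' w' Y' a j v w Y
                       (λ m' m → trans (Sh'.merged-stars m') (sym (merged-stars m))) (sym T≡S') (sym k≡j'))
      uncrossed
      (shape-validLadder empties sh) (shape-validLadder empties' sh'))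
  where
  open SplitShape sh
  module Sh' = SplitShape sh'
  open Sh' using () renaming (a to a'; j to j'; Y to Y')
  S≢S' : unsplit a j v w Y ≢ unsplit a' j' v' w' Y'
  S≢S' S≡S' = g≢g' (trans g≡unsplit (trans S≡S' (sym Sh'.g≡unsplit)))
  uncrossed : unsplit a j v w Y ≡ split a' j' v' w' Y' → split a j v w Y ≢ unsplit a' j' v' w' Y'
  uncrossed S≡T' T≡S' = n≢4+n (begin
    numStars (unsplit a j v w Y)                  ≡⟨ cong numStars S≡T' ⟩
    numStars (split a' j' v' w' Y')               ≡⟨ numStars-split a' j' v' w' Y' ⟩
    suc (suc (numStars (unsplit a' j' v' w' Y'))) ≡⟨ cong (λ s → suc (suc (numStars s))) (sym T≡S') ⟩
    suc (suc (numStars (split a j v w Y)))        ≡⟨ cong (λ k → suc (suc k)) (numStars-split a j v w Y) ⟩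
    suc (suc (suc (suc (numStars (unsplit a j v w Y))))) ∎)
    where open ≡-Reasoning

data FirstBlock : List Bits → Set where
  firstBlock : ∀ {pre} post {v w} → All (_≡ []) pre → Dyck v → Dyck w →
               FirstBlock (pre ++ (false ∷ v ++ true ∷ w) ∷ post)

-- A chain with only empty inner blocks has length h ≤ 2ℓ - 3 < n.
validChain-firstBlock : ∀ {m ℓ us} → ℓ ≤ suc m → ValidChain (2 * m + 1) ℓ us → FirstBlock us
validChain-firstBlock {m} {ℓ} {us} ℓ≤ (ds , |C| , _ , h≤) with empties-or-nonempty us
... | inj₁ empties = ⊥-elim (1+n≰n (begin
  suc (2 * m)          ≡⟨ +-comm 1 (2 * m) ⟩
  2 * m + 1            ≡⟨ sym |C| ⟩
  length (chainStr us) ≡⟨ length-blocks-empties (++⁺ empties (refl ∷ [])) ⟩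
  length (us ++ [] ∷ []) ≡⟨ trans (length-++ us) (+-comm (length us) 1) ⟩
  suc (length us)      ≤⟨ h≤ ⟩
  2 * ℓ ∸ 3            ≤⟨ ∸-monoˡ-≤ 3 (*-monoʳ-≤ 2 ℓ≤) ⟩
  2 * suc m ∸ 3        ≡⟨ cong (_∸ 3) (*-suc 2 m) ⟩
  2 * m ∸ 1            ≤⟨ m∸n≤m (2 * m) 1 ⟩
  2 * m                ∎))
  where open ≤-Reasoning
... | inj₂ (pre , u , post , refl , empties , u≢[]) with dyck-decompose (D⇒Dyck (All.head (++⁻ʳ pre ds))) u≢[]
...   | u≡ , dv , dw = subst (λ x → FirstBlock (pre ++ x ∷ post)) (sym u≡) (firstBlock post empties dv dw)

flipCycle-flipping : ∀ {n ℓ pre} post {v w} → ValidChain n ℓ (pre ++ (false ∷ v ++ true ∷ w) ∷ post) →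
  All (_≡ []) pre → Dyck v → Dyck w →
  Is4Cycle n (flipCycle ℓ (pre ++ (false ∷ v ++ true ∷ w) ∷ post)) ×
  Flipping (flipCycle ℓ (pre ++ (false ∷ v ++ true ∷ w) ∷ post)) (g ℓ (pre ++ (false ∷ v ++ true ∷ w) ∷ post))
           (pg ℓ (pre ++ (false ∷ v ++ true ∷ w) ∷ post) pre v w)
flipCycle-flipping {n} {ℓ} {pre} post {v} {w} V empties dv dw =
  subst (λ c → Is4Cycle n c × Flipping c (g ℓ us) (pg ℓ us pre v w)) (sym (flipCycle≡ladderAt ℓ post v w empties dv))
    (shape-is4Cycle empties sh , shape-flipping empties sh)
  where
  us = pre ++ (false ∷ v ++ true ∷ w) ∷ post
  sh = splitShape {ℓ} {n} V empties dv dw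

flipCycles-edgeDisjoint : ∀ {n ℓ us us'} → ValidChain n ℓ us → ValidChain n ℓ us' → FirstBlock us → FirstBlock us' →
                          us ≢ us' → EdgeDisjoint (flipCycle ℓ us) (flipCycle ℓ us')
flipCycles-edgeDisjoint {ℓ = ℓ} V V' (firstBlock post {v} {w} empties dv dw) (firstBlock post' {v'} {w'} empties' dv' dw')
                        us≢us' =
  subst₂ EdgeDisjoint (sym (flipCycle≡ladderAt ℓ post v w empties dv))
                      (sym (flipCycle≡ladderAt ℓ post' v' w' empties' dv'))
    (shapes-edgeDisjoint empties empties' (splitShape {ℓ} V empties dv dw) (splitShape {ℓ} V' empties' dv' dw')
      (λ g≡g' → us≢us' (g-injective {ℓ = ℓ} V V' g≡g')))

lemma14 : (m ℓ : ℕ) → 1 ≤ m → 2 ≤ ℓ → ℓ ≤ suc m →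
    Σ (List Bits → Cycle4) λ F →
      (∀ us → ValidChain (2 * m + 1) ℓ us →
        Is4Cycle (2 * m + 1) (F us) ×
        (∀ pre u post v w → us ≡ pre ++ u ∷ post → All (_≡ []) pre →
          u ≡ false ∷ v ++ true ∷ w → D v → D w →
          Flipping (F us) (g ℓ us) (pg ℓ us pre v w))) ×
      (∀ us us' → ValidChain (2 * m + 1) ℓ us → ValidChain (2 * m + 1) ℓ us' →
        us ≢ us' → EdgeDisjoint (F us) (F us'))
lemma14 m ℓ _ _ ℓ≤ =
  flipCycle ℓ ,
  (λ us V → is4Cycle (validChain-firstBlock ℓ≤ V) V , flipping us V) ,
  (λ us us' V V' → flipCycles-edgeDisjoint {ℓ = ℓ} V V' (validChain-firstBlock ℓ≤ V) (validChain-firstBlock ℓ≤ V'))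
  where
  is4Cycle : ∀ {us} → FirstBlock us → ValidChain (2 * m + 1) ℓ us → Is4Cycle (2 * m + 1) (flipCycle ℓ us)
  is4Cycle (firstBlock post empties dv dw) V = proj₁ (flipCycle-flipping {ℓ = ℓ} post V empties dv dw)

  flipping : ∀ us → ValidChain (2 * m + 1) ℓ us → ∀ pre u post v w → us ≡ pre ++ u ∷ post → All (_≡ []) pre →
             u ≡ false ∷ v ++ true ∷ w → D v → D w → Flipping (flipCycle ℓ us) (g ℓ us) (pg ℓ us pre v w)
  flipping _ V pre _ post v w refl empties refl Dv Dw =
    proj₂ (flipCycle-flipping {ℓ = ℓ} post V empties (D⇒Dyck Dv) (D⇒Dyck Dw))
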